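{- The set $\mathrm{Inc}(\{K_{2,p} : p\in\mathbb{N},\ p\geq 3\})$ is well-quasi-ordered by the contraction relation.
   Context: Graphs are finite, simple, up to isomorphism. Contracting an edge $\{u,v\}$ means adding a new vertex adjacent to all neighbours of $u$ and $v$ and deleting $u,v$; $H\le G$ if $H$ is a contraction of $G$, i.e. obtained by a sequence of edge contractions. For a set $A$ of graphs, $\mathrm{Inc}(A)=\{x : \exists y\in A,\ x\le y,\ x\neq y\}$. A well-quasi-order is a quasi-order with no infinite strictly decreasing sequence and no infinite antichain. -}

module Defs where

open import Data.Nat using (ℕ; zero; suc; _+_; _≥_; _<ᵇ_)
open import Data.Fin using (Fin; toℕ)
open import Data.Bool using (Bool; true; false; _xor_)
open import Data.Bool.Properties using (xor-same)
open import Data.Product using (Σ; ∃; ∃-syntax; _×_; _,_)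
open import Data.Sum using (_⊎_)
open import Relation.Binary.PropositionalEquality using (_≡_; _≢_)
open import Relation.Nullary using (¬_)
open import Function.Bundles using (_⇔_)

record Graph : Set where
  field
    n      : ℕ
    adj    : Fin n → Fin n → Bool
    sym    : ∀ x y → adj x y ≡ adj y x
    irrefl : ∀ x → adj x x ≡ false
open Graph public

record Iso (G H : Graph) : Set where
  field
    to       : Fin (n G) → Fin (n H)
    from     : Fin (n H) → Fin (n G)
    from-to  : ∀ x → from (to x) ≡ x
    to-from  : ∀ y → to (from y) ≡ y
    adj-pres : ∀ x y → adj G x y ≡ adj H (to x) (to y)

-- H is (isomorphic to) the graph obtained from G by contracting the edge {u,v}:
-- the map φ identifies exactly u and v (the new vertex φ u = φ v), is a
-- bijection elsewhere, and two distinct vertices of H are adjacent iff some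
-- of their preimages are adjacent in G (so the new vertex is adjacent exactly
-- to the neighbours of u and v).
record Contract1 (G H : Graph) : Set where
  field
    φ     : Fin (n G) → Fin (n H)
    u v   : Fin (n G)
    edge  : adj G u v ≡ true
    surj  : ∀ a → ∃[ x ] φ x ≡ a
    merge : φ u ≡ φ v
    inj   : ∀ x y → φ x ≡ φ y → x ≡ y ⊎ ((x ≡ u × y ≡ v) ⊎ (x ≡ v × y ≡ u))
    adjH  : ∀ a b → a ≢ b →
            (adj H a b ≡ true) ⇔ (∃[ x ] ∃[ y ] (φ x ≡ a × φ y ≡ b × adj G x y ≡ true))

data _≤c_ : Graph → Graph → Set where
  done : ∀ {H G} → Iso G H → H ≤c G
  step : ∀ {H G G'} → Contract1 G G' → H ≤c G' → H ≤c G

-- Complete bipartite graph K_{2,p} on Fin (2 + p): vertices 0,1 form one side.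
K2-adj : ∀ p → Fin (2 + p) → Fin (2 + p) → Bool
K2-adj p i j = (toℕ i <ᵇ 2) xor (toℕ j <ᵇ 2)

private
  xor-comm : ∀ a b → a xor b ≡ b xor a
  xor-comm true true = _≡_.refl
  xor-comm true false = _≡_.refl
  xor-comm false true = _≡_.refl
  xor-comm false false = _≡_.refl

K2 : ℕ → Graph
K2 p = record
  { n = 2 + p
  ; adj = K2-adj p
  ; sym = λ i j → xor-comm (toℕ i <ᵇ 2) (toℕ j <ᵇ 2)
  ; irrefl = λ i → xor-same (toℕ i <ᵇ 2)
  }

InA : Graph → Set
InA y = ∃[ p ] (p ≥ 3 × Iso y (K2 p))

Inc : (Graph → Set) → Graph → Set
Inc A x = ∃[ y ] (A y × x ≤c y × ¬ Iso x y)

_<c_ : Graph → Graph → Set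
x <c y = x ≤c y × ¬ (y ≤c x)

WQO : (Graph → Set) → Set
WQO S =
  (∀ (f : ℕ → Graph) → (∀ i → S (f i)) → ¬ (∀ i → f (suc i) <c f i))
  × (∀ (f : ℕ → Graph) → (∀ i → S (f i)) →
       ¬ (∀ i j → i ≢ j → ¬ (f i ≤c f j) × ¬ (f j ≤c f i)))

-- Every edge of K₂,ₚ joins one of its two hubs to a leaf, and all such edges are
-- equivalent under automorphisms, so contracting any of them gives K₁,₁,ₚ₋₁ (the
-- two hubs now adjacent).  Contracting an edge of K₁,₁,ₖ gives K₁,₁,ₖ₋₁ (a
-- hub–leaf edge) or the star K₁,ₖ (the hub–hub edge), and a star only contracts
-- to smaller stars.  Hence every proper contraction of some K₂,ₚ lies on one of
-- the two chains (K₁,₁,ₖ)ₖ and (K₁,ₘ)ₘ, each totally ordered by contraction: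
-- by pigeonhole an antichain has at most two elements.  Strictly descending
-- sequences are finite because a contraction removes a vertex.
module Submission where

open import Defs hiding (sym)
open import Data.Bool using (Bool; true; false)
open import Data.Empty using (⊥-elim)
open import Data.Fin using (Fin; toℕ) renaming (zero to fzero; suc to fsuc)
open import Data.Fin.Patterns using (0F; 1F)
open import Data.Fin.Permutation using (Permutation; Permutation′; _⟨$⟩ʳ_; _⟨$⟩ˡ_; inverseˡ; inverseʳ; id; lift₀; transpose)
import Data.Fin.Permutation.Components as PC
open import Data.Fin.Properties using (_≟_; injective⇒≤; pigeonhole)
open import Data.Nat using (ℕ; zero; suc; _+_; _≤_; _<_; _≤′_; ≤′-refl; ≤′-step)
open import Data.Nat.Induction using (<-wellFounded)
open import Data.Nat.Properties using (≤-trans; <⇒≤; ≤-<-trans; ≤-total; ≤⇒≤′; n<1+n; <⇒≢)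
open import Data.Product using (∃-syntax; Σ-syntax; _×_; _,_; proj₁; proj₂)
open import Data.Sum using (_⊎_; inj₁; inj₂; [_,_]′)
import Data.Sum as Sum
open import Function using (_∘_)
open import Function.Bundles using (_⇔_; mk⇔; Equivalence)
open import Function.Definitions using (Injective)
open import Induction.InfiniteDescent using (Descent; InfiniteDescendingSequence; InfiniteDescendingSequenceFrom; descent∧wf⇒empty)
open import Relation.Binary.PropositionalEquality
open import Relation.Nullary using (¬_; yes; no)
open import Relation.Nullary.Decidable using (dec-true)

open Iso
open Contract1

private
  variable
    G G′ H H′ : Graph

Iso-refl : Iso G G
Iso-refl = record
  { to = λ x → x ; from = λ x → x ; from-to = λ _ → refl ; to-from = λ _ → refl
  ; adj-pres = λ _ _ → refl }

Iso-sym : Iso G H → Iso H G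
Iso-sym {G} {H} σ = record
  { to = from σ ; from = to σ ; from-to = to-from σ ; to-from = from-to σ
  ; adj-pres = λ x y → begin
      adj H x y                                 ≡⟨ cong₂ (adj H) (to-from σ x) (to-from σ y) ⟨
      adj H (to σ (from σ x)) (to σ (from σ y)) ≡⟨ adj-pres σ (from σ x) (from σ y) ⟨
      adj G (from σ x) (from σ y)               ∎ }
  where open ≡-Reasoning

Iso-trans : ∀ {K} → Iso G H → Iso H K → Iso G K
Iso-trans σ τ = record
  { to = to τ ∘ to σ ; from = from σ ∘ from τ
  ; from-to = λ x → trans (cong (from σ) (from-to τ (to σ x))) (from-to σ x)
  ; to-from = λ x → trans (cong (to τ) (to-from σ (from τ x))) (to-from τ x)
  ; adj-pres = λ x y → trans (adj-pres σ x y) (adj-pres τ (to σ x) (to σ y)) }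

permutation⇒Iso : (π : Permutation (n G) (n H)) →
                  (∀ x y → adj G x y ≡ adj H (π ⟨$⟩ʳ x) (π ⟨$⟩ʳ y)) → Iso G H
permutation⇒Iso π pres = record
  { to = π ⟨$⟩ʳ_ ; from = π ⟨$⟩ˡ_ ; from-to = λ _ → inverseˡ π ; to-from = λ _ → inverseʳ π
  ; adj-pres = pres }

Iso⇒≤ : Iso G H → n G ≤ n H
Iso⇒≤ σ = injective⇒≤ λ {x} {y} e →
  trans (sym (from-to σ x)) (trans (cong (from σ) e) (from-to σ y))

-- Edge contractions

SameEdge : ∀ {A : Set} → A → A → A → A → Set
SameEdge x y a b = (x ≡ a × y ≡ b) ⊎ (x ≡ b × y ≡ a)

SameEdge-sym : ∀ {A : Set} {x y a b : A} → SameEdge x y a b → SameEdge a b x y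
SameEdge-sym (inj₁ (refl , refl)) = inj₁ (refl , refl)
SameEdge-sym (inj₂ (refl , refl)) = inj₂ (refl , refl)

SameEdge-map : ∀ {A B : Set} (f : A → B) {x y a b : A} {a′ b′ : B} → f a ≡ a′ → f b ≡ b′ →
               SameEdge x y a b → SameEdge (f x) (f y) a′ b′
SameEdge-map f fa fb (inj₁ (refl , refl)) = inj₁ (fa , fb)
SameEdge-map f fa fb (inj₂ (refl , refl)) = inj₂ (fb , fa)

⇔-true⇒≡ : ∀ {a b : Bool} → (a ≡ true ⇔ b ≡ true) → a ≡ b
⇔-true⇒≡ {true}  {true}  _ = refl
⇔-true⇒≡ {true}  {false} e = sym (Equivalence.to e refl)
⇔-true⇒≡ {false} {true}  e = Equivalence.from e refl
⇔-true⇒≡ {false} {false} _ = refl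

-- ι picks a representative of every vertex of H; the merged vertex is represented by u.
mkContract1 : (φ : Fin (n G) → Fin (n H)) (ι : Fin (n H) → Fin (n G)) (u v : Fin (n G)) →
              adj G u v ≡ true → φ u ≡ φ v →
              (∀ a → φ (ι a) ≡ a) →
              (∀ x → ι (φ x) ≡ x ⊎ (x ≡ v × ι (φ x) ≡ u)) →
              (∀ a b → adj H a b ≡ true → ∃[ x ] ∃[ y ] (φ x ≡ a × φ y ≡ b × adj G x y ≡ true)) →
              (∀ x y → adj G x y ≡ true → φ x ≢ φ y → adj H (φ x) (φ y) ≡ true) →
              Contract1 G H
mkContract1 {G} {H} φ ι u v uv φu≡φv φι retract forth back = record
  { φ = φ ; u = u ; v = v ; edge = uv ; merge = φu≡φv
  ; surj = λ a → ι a , φι a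
  ; inj = merges-only
  ; adjH = λ a b a≢b → mk⇔ (forth a b) λ { (x , y , refl , refl , xy) → back x y xy a≢b } }
  where
  merges-only : ∀ x y → φ x ≡ φ y → x ≡ y ⊎ SameEdge x y u v
  merges-only x y e with retract x | retract y
  ... | inj₁ rx          | inj₁ ry          = inj₁ (trans (sym rx) (trans (cong ι e) ry))
  ... | inj₁ rx          | inj₂ (refl , ry) = inj₂ (inj₁ (trans (sym rx) (trans (cong ι e) ry) , refl))
  ... | inj₂ (refl , rx) | inj₁ ry          = inj₂ (inj₂ (refl , trans (sym ry) (trans (cong ι (sym e)) rx)))
  ... | inj₂ (refl , _)  | inj₂ (refl , _)  = inj₁ refl

Contract1-respˡ-Iso : Iso G G′ → Contract1 G H → Contract1 G′ H
Contract1-respˡ-Iso {G} {G′} {H} σ c = record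
  { φ = φ c ∘ from σ
  ; u = to σ (u c) ; v = to σ (v c)
  ; edge = trans (sym (adj-pres σ (u c) (v c))) (edge c)
  ; surj = λ a → to σ (proj₁ (surj c a)) , trans (cong (φ c) (from-to σ _)) (proj₂ (surj c a))
  ; merge = trans (φ-to (u c)) (trans (merge c) (sym (φ-to (v c))))
  ; inj = λ a b e → subst₂ (λ a′ b′ → a′ ≡ b′ ⊎ SameEdge a′ b′ _ _) (to-from σ a) (to-from σ b)
                      (Sum.map (cong (to σ)) (SameEdge-map (to σ) refl refl) (inj c (from σ a) (from σ b) e))
  ; adjH = λ a b a≢b → mk⇔ (forth ∘ Equivalence.to (adjH c a b a≢b))
                           (Equivalence.from (adjH c a b a≢b) ∘ back) }
  where
  φ-to : ∀ x → φ c (from σ (to σ x)) ≡ φ c x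
  φ-to x = cong (φ c) (from-to σ x)
  forth : ∀ {a b} → ∃[ x ] ∃[ y ] (φ c x ≡ a × φ c y ≡ b × adj G x y ≡ true) →
          ∃[ x ] ∃[ y ] (φ c (from σ x) ≡ a × φ c (from σ y) ≡ b × adj G′ x y ≡ true)
  forth (x , y , ex , ey , xy) =
    to σ x , to σ y , trans (φ-to x) ex , trans (φ-to y) ey , trans (sym (adj-pres σ x y)) xy
  back : ∀ {a b} → ∃[ x ] ∃[ y ] (φ c (from σ x) ≡ a × φ c (from σ y) ≡ b × adj G′ x y ≡ true) →
         ∃[ x ] ∃[ y ] (φ c x ≡ a × φ c y ≡ b × adj G x y ≡ true)
  back (x , y , ex , ey , xy) = from σ x , from σ y , ex , ey ,
    trans (adj-pres σ (from σ x) (from σ y)) (trans (cong₂ (adj G′) (to-from σ x) (to-from σ y)) xy)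

Contract1-factors : ∀ {A : Set} (c : Contract1 G H) (ψ : Fin (n G) → A) → ψ (u c) ≡ ψ (v c) →
                    ∀ {x y} → φ c x ≡ φ c y → ψ x ≡ ψ y
Contract1-factors c ψ ψu≡ψv {x} {y} e with inj c x y e
... | inj₁ refl                 = refl
... | inj₂ (inj₁ (refl , refl)) = ψu≡ψv
... | inj₂ (inj₂ (refl , refl)) = sym ψu≡ψv

Contract1-merges : (c : Contract1 G H) → ∀ {x y} → SameEdge x y (u c) (v c) → φ c x ≡ φ c y
Contract1-merges c (inj₁ (refl , refl)) = merge c
Contract1-merges c (inj₂ (refl , refl)) = sym (merge c)

Contract1-unique : (c : Contract1 G H) (c′ : Contract1 G H′) →
                   SameEdge (u c) (v c) (u c′) (v c′) → Iso H H′
Contract1-unique {G} {H} {H′} c c′ e = record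
  { to = T ; from = F ; from-to = from-to′ ; to-from = to-from′ ; adj-pres = pres }
  where
  T : Fin (n H) → Fin (n H′)
  T a = φ c′ (proj₁ (surj c a))
  F : Fin (n H′) → Fin (n H)
  F b = φ c (proj₁ (surj c′ b))
  T-φ : ∀ x → T (φ c x) ≡ φ c′ x
  T-φ x = Contract1-factors c (φ c′) (Contract1-merges c′ e) (proj₂ (surj c (φ c x)))
  F-φ : ∀ x → F (φ c′ x) ≡ φ c x
  F-φ x = Contract1-factors c′ (φ c) (Contract1-merges c (SameEdge-sym e)) (proj₂ (surj c′ (φ c′ x)))
  from-to′ : ∀ a → F (T a) ≡ a
  from-to′ a = trans (F-φ _) (proj₂ (surj c a))
  to-from′ : ∀ b → T (F b) ≡ b
  to-from′ b = trans (T-φ _) (proj₂ (surj c′ b))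
  pres : ∀ a b → adj H a b ≡ adj H′ (T a) (T b)
  pres a b with a ≟ b
  ... | yes refl = trans (irrefl H a) (sym (irrefl H′ (T a)))
  ... | no a≢b   = ⇔-true⇒≡ (mk⇔ forth back)
    where
    Ta≢Tb : T a ≢ T b
    Ta≢Tb Ta≡Tb = a≢b (trans (sym (from-to′ a)) (trans (cong F Ta≡Tb) (from-to′ b)))
    forth : adj H a b ≡ true → adj H′ (T a) (T b) ≡ true
    forth ab with x , y , refl , refl , xy ← Equivalence.to (adjH c a b a≢b) ab =
      Equivalence.from (adjH c′ (T _) (T _) Ta≢Tb) (x , y , sym (T-φ x) , sym (T-φ y) , xy)
    back : adj H′ (T a) (T b) ≡ true → adj H a b ≡ true
    back ab with x , y , ex , ey , xy ← Equivalence.to (adjH c′ (T a) (T b) Ta≢Tb) ab =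
      Equivalence.from (adjH c a b a≢b)
        ( x , y , trans (sym (F-φ x)) (trans (cong F ex) (from-to′ a))
        , trans (sym (F-φ y)) (trans (cong F ey) (from-to′ b)) , xy )

∉-image⇒< : ∀ {m k} (s : Fin m → Fin k) → Injective _≡_ _≡_ s →
            (w : Fin k) → (∀ a → w ≢ s a) → m < k
∉-image⇒< s s-inj w w∉s = injective⇒≤ extend-inj
  where
  extend : Fin (suc _) → Fin _
  extend fzero    = w
  extend (fsuc a) = s a
  extend-inj : Injective _≡_ _≡_ extend
  extend-inj {fzero}  {fzero}  _ = refl
  extend-inj {fzero}  {fsuc b} e = ⊥-elim (w∉s b e)
  extend-inj {fsuc a} {fzero}  e = ⊥-elim (w∉s a (sym e))
  extend-inj {fsuc a} {fsuc b} e = cong fsuc (s-inj e)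

Contract1⇒< : Contract1 G H → n H < n G
Contract1⇒< {G} c = ∉-image⇒< s s-inj w w∉s
  where
  s = λ a → proj₁ (surj c a)
  φs : ∀ a → φ c (s a) ≡ a
  φs a = proj₂ (surj c a)
  s-inj : Injective _≡_ _≡_ s
  s-inj {a} {b} e = trans (sym (φs a)) (trans (cong (φ c) e) (φs b))
  u≢v : u c ≢ v c
  u≢v u≡v with () ← trans (sym (edge c)) (trans (cong (adj G (u c)) (sym u≡v)) (irrefl G (u c)))
  -- u and v share the image φ u, but only one of them is its chosen preimage.
  W : Σ[ w ∈ Fin (n G) ] (φ c w ≡ φ c (u c) × w ≢ s (φ c (u c)))
  W with u c ≟ s (φ c (u c))
  ... | no u≢s  = u c , refl , u≢s
  ... | yes u≡s = v c , sym (merge c) , λ v≡s → u≢v (trans u≡s (sym v≡s))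
  w = proj₁ W
  w∉s : ∀ a → w ≢ s a
  w∉s a w≡sa = proj₂ (proj₂ W) (trans w≡sa (cong s a≡φu))
    where
    a≡φu : a ≡ φ c (u c)
    a≡φu = trans (sym (φs a)) (trans (cong (φ c) (sym w≡sa)) (proj₁ (proj₂ W)))

≤c⇒≤ : H ≤c G → n H ≤ n G
≤c⇒≤ (done σ)   = Iso⇒≤ (Iso-sym σ)
≤c⇒≤ (step c r) = ≤-trans (≤c⇒≤ r) (<⇒≤ (Contract1⇒< c))

<c⇒< : H <c G → n H < n G
<c⇒< (done σ   , G≰H) = ⊥-elim (G≰H (done (Iso-sym σ)))
<c⇒< (step c r , _)   = ≤-<-trans (≤c⇒≤ r) (Contract1⇒< c)

ℕ-noInfiniteDescent : (g : ℕ → ℕ) → ¬ InfiniteDescendingSequence _<_ g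
ℕ-noInfiniteDescent g g↓ = descent∧wf⇒empty shift <-wellFounded (g 0) (g , refl , g↓)
  where
  shift : Descent _<_ (λ m → ∃[ h ] InfiniteDescendingSequenceFrom _<_ h m)
  shift (h , refl , h↓) = h 1 , h↓ 0 , h ∘ suc , refl , h↓ ∘ suc

<c-noInfiniteDescent : (f : ℕ → Graph) → ¬ (∀ i → f (suc i) <c f i)
<c-noInfiniteDescent f f↓ = ℕ-noInfiniteDescent (n ∘ f) (<c⇒< ∘ f↓)

≤c-respˡ-Iso : Iso H′ H → H ≤c G → H′ ≤c G
≤c-respˡ-Iso σ (done τ)   = done (Iso-trans τ (Iso-sym σ))
≤c-respˡ-Iso σ (step c r) = step c (≤c-respˡ-Iso σ r)

≤c-respʳ-Iso : Iso G′ G → H ≤c G → H ≤c G′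
≤c-respʳ-Iso σ (done τ)   = done (Iso-trans σ τ)
≤c-respʳ-Iso σ (step c r) = step (Contract1-respˡ-Iso (Iso-sym σ) c) r

-- Two hubs joined to k leaves; twoHub false k is K₂,ₖ and twoHub true k is K₁,₁,ₖ.

pattern hub₀ = 0F
pattern hub₁ = 1F
pattern leaf j = fsuc (fsuc j)

twoHub-adj : Bool → ∀ {k} → Fin (2 + k) → Fin (2 + k) → Bool
twoHub-adj b hub₀     hub₀     = false
twoHub-adj b hub₀     hub₁     = b
twoHub-adj b hub₀     (leaf _) = true
twoHub-adj b hub₁     hub₀     = b
twoHub-adj b hub₁     hub₁     = false
twoHub-adj b hub₁     (leaf _) = true
twoHub-adj b (leaf _) hub₀     = true
twoHub-adj b (leaf _) hub₁     = true
twoHub-adj b (leaf _) (leaf _) = false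

twoHub-adj-sym : ∀ b {k} (x y : Fin (2 + k)) → twoHub-adj b x y ≡ twoHub-adj b y x
twoHub-adj-sym b hub₀     hub₀     = refl
twoHub-adj-sym b hub₀     hub₁     = refl
twoHub-adj-sym b hub₀     (leaf _) = refl
twoHub-adj-sym b hub₁     hub₀     = refl
twoHub-adj-sym b hub₁     hub₁     = refl
twoHub-adj-sym b hub₁     (leaf _) = refl
twoHub-adj-sym b (leaf _) hub₀     = refl
twoHub-adj-sym b (leaf _) hub₁     = refl
twoHub-adj-sym b (leaf _) (leaf _) = refl

twoHub-adj-irrefl : ∀ b {k} (x : Fin (2 + k)) → twoHub-adj b x x ≡ false
twoHub-adj-irrefl b hub₀     = refl
twoHub-adj-irrefl b hub₁     = refl
twoHub-adj-irrefl b (leaf _) = refl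

twoHub : Bool → ℕ → Graph
twoHub b k = record
  { n = 2 + k ; adj = twoHub-adj b ; sym = twoHub-adj-sym b ; irrefl = twoHub-adj-irrefl b }

fan : ℕ → Graph
fan = twoHub true

K2-Iso-twoHub : ∀ p → Iso (K2 p) (twoHub false p)
K2-Iso-twoHub p = permutation⇒Iso id pres
  where
  pres : ∀ x y → K2-adj p x y ≡ twoHub-adj false x y
  pres hub₀     hub₀     = refl
  pres hub₀     hub₁     = refl
  pres hub₀     (leaf _) = refl
  pres hub₁     hub₀     = refl
  pres hub₁     hub₁     = refl
  pres hub₁     (leaf _) = refl
  pres (leaf _) hub₀     = refl
  pres (leaf _) hub₁     = refl
  pres (leaf _) (leaf _) = refl

pattern centre = 0F
pattern ray j = fsuc j

star-adj : ∀ {m} → Fin (1 + m) → Fin (1 + m) → Bool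
star-adj centre  centre  = false
star-adj centre  (ray _) = true
star-adj (ray _) centre  = true
star-adj (ray _) (ray _) = false

star-adj-sym : ∀ {m} (x y : Fin (1 + m)) → star-adj x y ≡ star-adj y x
star-adj-sym centre  centre  = refl
star-adj-sym centre  (ray _) = refl
star-adj-sym (ray _) centre  = refl
star-adj-sym (ray _) (ray _) = refl

star-adj-irrefl : ∀ {m} (x : Fin (1 + m)) → star-adj x x ≡ false
star-adj-irrefl centre  = refl
star-adj-irrefl (ray _) = refl

star : ℕ → Graph
star m = record { n = 1 + m ; adj = star-adj ; sym = star-adj-sym ; irrefl = star-adj-irrefl }

contract-hub₀-leaf₀ : ∀ {b} k → Contract1 (twoHub b (suc k)) (fan k)
contract-hub₀-leaf₀ {b} k = mkContract1 κ ι hub₀ (leaf 0F) refl refl κι retract forth back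
  where
  κ : Fin (2 + suc k) → Fin (2 + k)
  κ hub₀            = hub₀
  κ hub₁            = hub₁
  κ (leaf 0F)       = hub₀
  κ (leaf (fsuc j)) = leaf j
  ι : Fin (2 + k) → Fin (2 + suc k)
  ι hub₀     = hub₀
  ι hub₁     = hub₁
  ι (leaf j) = leaf (fsuc j)
  κι : ∀ a → κ (ι a) ≡ a
  κι hub₀     = refl
  κι hub₁     = refl
  κι (leaf _) = refl
  retract : ∀ x → ι (κ x) ≡ x ⊎ (x ≡ leaf 0F × ι (κ x) ≡ hub₀)
  retract hub₀            = inj₁ refl
  retract hub₁            = inj₁ refl
  retract (leaf 0F)       = inj₂ (refl , refl)
  retract (leaf (fsuc _)) = inj₁ refl
  forth : ∀ a c → twoHub-adj true a c ≡ true →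
          ∃[ x ] ∃[ y ] (κ x ≡ a × κ y ≡ c × twoHub-adj b x y ≡ true)
  forth hub₀     hub₁     _ = leaf 0F , hub₁ , refl , refl , refl
  forth hub₀     (leaf j) _ = hub₀ , leaf (fsuc j) , refl , refl , refl
  forth hub₁     hub₀     _ = hub₁ , leaf 0F , refl , refl , refl
  forth hub₁     (leaf j) _ = hub₁ , leaf (fsuc j) , refl , refl , refl
  forth (leaf j) hub₀     _ = leaf (fsuc j) , hub₀ , refl , refl , refl
  forth (leaf j) hub₁     _ = leaf (fsuc j) , hub₁ , refl , refl , refl
  back : ∀ x y → twoHub-adj b x y ≡ true → κ x ≢ κ y → twoHub-adj true (κ x) (κ y) ≡ true
  back hub₀            hub₁            _ _  = refl
  back hub₀            (leaf 0F)       _ ne = ⊥-elim (ne refl)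
  back hub₀            (leaf (fsuc _)) _ _  = refl
  back hub₁            hub₀            _ _  = refl
  back hub₁            (leaf 0F)       _ _  = refl
  back hub₁            (leaf (fsuc _)) _ _  = refl
  back (leaf 0F)       hub₀            _ ne = ⊥-elim (ne refl)
  back (leaf 0F)       hub₁            _ _  = refl
  back (leaf (fsuc _)) hub₀            _ _  = refl
  back (leaf (fsuc _)) hub₁            _ _  = refl

contract-hub₀-hub₁ : ∀ k → Contract1 (fan k) (star k)
contract-hub₀-hub₁ k = mkContract1 κ ι hub₀ hub₁ refl refl κι retract forth back
  where
  κ : Fin (2 + k) → Fin (1 + k)
  κ hub₀     = centre
  κ hub₁     = centre
  κ (leaf j) = ray j
  ι : Fin (1 + k) → Fin (2 + k)
  ι centre  = hub₀
  ι (ray j) = leaf j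
  κι : ∀ a → κ (ι a) ≡ a
  κι centre  = refl
  κι (ray _) = refl
  retract : ∀ x → ι (κ x) ≡ x ⊎ (x ≡ hub₁ × ι (κ x) ≡ hub₀)
  retract hub₀     = inj₁ refl
  retract hub₁     = inj₂ (refl , refl)
  retract (leaf _) = inj₁ refl
  forth : ∀ a c → star-adj a c ≡ true →
          ∃[ x ] ∃[ y ] (κ x ≡ a × κ y ≡ c × twoHub-adj true x y ≡ true)
  forth centre  (ray j) _ = hub₀ , leaf j , refl , refl , refl
  forth (ray j) centre  _ = leaf j , hub₀ , refl , refl , refl
  back : ∀ x y → twoHub-adj true x y ≡ true → κ x ≢ κ y → star-adj (κ x) (κ y) ≡ true
  back hub₀     hub₁     _ ne = ⊥-elim (ne refl)
  back hub₀     (leaf _) _ _  = refl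
  back hub₁     hub₀     _ ne = ⊥-elim (ne refl)
  back hub₁     (leaf _) _ _  = refl
  back (leaf _) hub₀     _ _  = refl
  back (leaf _) hub₁     _ _  = refl

contract-centre-ray₀ : ∀ m → Contract1 (star (suc m)) (star m)
contract-centre-ray₀ m = mkContract1 κ ι centre (ray 0F) refl refl κι retract forth back
  where
  κ : Fin (1 + suc m) → Fin (1 + m)
  κ centre         = centre
  κ (ray 0F)       = centre
  κ (ray (fsuc j)) = ray j
  ι : Fin (1 + m) → Fin (1 + suc m)
  ι centre  = centre
  ι (ray j) = ray (fsuc j)
  κι : ∀ a → κ (ι a) ≡ a
  κι centre  = refl
  κι (ray _) = refl
  retract : ∀ x → ι (κ x) ≡ x ⊎ (x ≡ ray 0F × ι (κ x) ≡ centre)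
  retract centre         = inj₁ refl
  retract (ray 0F)       = inj₂ (refl , refl)
  retract (ray (fsuc _)) = inj₁ refl
  forth : ∀ a c → star-adj a c ≡ true →
          ∃[ x ] ∃[ y ] (κ x ≡ a × κ y ≡ c × star-adj x y ≡ true)
  forth centre  (ray j) _ = centre , ray (fsuc j) , refl , refl , refl
  forth (ray j) centre  _ = ray (fsuc j) , centre , refl , refl , refl
  back : ∀ x y → star-adj x y ≡ true → κ x ≢ κ y → star-adj (κ x) (κ y) ≡ true
  back centre         (ray 0F)       _ ne = ⊥-elim (ne refl)
  back centre         (ray (fsuc _)) _ _  = refl
  back (ray 0F)       centre         _ ne = ⊥-elim (ne refl)
  back (ray (fsuc _)) centre         _ _  = refl

-- Automorphisms

permuteLeaves : ∀ {b k} → Permutation′ k → Iso (twoHub b k) (twoHub b k)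
permuteLeaves {b} ρ = permutation⇒Iso (lift₀ (lift₀ ρ)) pres
  where
  pres : ∀ x y → twoHub-adj b x y ≡ twoHub-adj b (lift₀ (lift₀ ρ) ⟨$⟩ʳ x) (lift₀ (lift₀ ρ) ⟨$⟩ʳ y)
  pres hub₀     hub₀     = refl
  pres hub₀     hub₁     = refl
  pres hub₀     (leaf _) = refl
  pres hub₁     hub₀     = refl
  pres hub₁     hub₁     = refl
  pres hub₁     (leaf _) = refl
  pres (leaf _) hub₀     = refl
  pres (leaf _) hub₁     = refl
  pres (leaf _) (leaf _) = refl

swapHubs : ∀ {b k} → Iso (twoHub b k) (twoHub b k)
swapHubs {b} = permutation⇒Iso (transpose hub₀ hub₁) pres
  where
  pres : ∀ x y → twoHub-adj b x y ≡ twoHub-adj b (transpose hub₀ hub₁ ⟨$⟩ʳ x) (transpose hub₀ hub₁ ⟨$⟩ʳ y)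
  pres hub₀     hub₀     = refl
  pres hub₀     hub₁     = refl
  pres hub₀     (leaf _) = refl
  pres hub₁     hub₀     = refl
  pres hub₁     hub₁     = refl
  pres hub₁     (leaf _) = refl
  pres (leaf _) hub₀     = refl
  pres (leaf _) hub₁     = refl
  pres (leaf _) (leaf _) = refl

permuteRays : ∀ {m} → Permutation′ m → Iso (star m) (star m)
permuteRays ρ = permutation⇒Iso (lift₀ ρ) pres
  where
  pres : ∀ x y → star-adj x y ≡ star-adj (lift₀ ρ ⟨$⟩ʳ x) (lift₀ ρ ⟨$⟩ʳ y)
  pres centre  centre  = refl
  pres centre  (ray _) = refl
  pres (ray _) centre  = refl
  pres (ray _) (ray _) = refl

transpose-here : ∀ {m} (i j : Fin m) → PC.transpose i j i ≡ j
transpose-here i j rewrite dec-true (i ≟ i) refl = refl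

twoHub-edge : ∀ b {k} (x y : Fin (2 + k)) → twoHub-adj b x y ≡ true →
              (b ≡ true × SameEdge x y hub₀ hub₁) ⊎
              ∃[ j ] (SameEdge x y hub₀ (leaf j) ⊎ SameEdge x y hub₁ (leaf j))
twoHub-edge b hub₀     hub₁     b≡true = inj₁ (b≡true , inj₁ (refl , refl))
twoHub-edge b hub₀     (leaf j) _      = inj₂ (j , inj₁ (inj₁ (refl , refl)))
twoHub-edge b hub₁     hub₀     b≡true = inj₁ (b≡true , inj₂ (refl , refl))
twoHub-edge b hub₁     (leaf j) _      = inj₂ (j , inj₂ (inj₁ (refl , refl)))
twoHub-edge b (leaf j) hub₀     _      = inj₂ (j , inj₁ (inj₂ (refl , refl)))
twoHub-edge b (leaf j) hub₁     _      = inj₂ (j , inj₂ (inj₂ (refl , refl)))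

hubLeaf-normalise : ∀ {b k} {x y : Fin (2 + suc k)} (j : Fin (suc k)) →
                    SameEdge x y hub₀ (leaf j) ⊎ SameEdge x y hub₁ (leaf j) →
                    Σ[ σ ∈ Iso (twoHub b (suc k)) (twoHub b (suc k)) ] SameEdge (to σ x) (to σ y) hub₀ (leaf 0F)
hubLeaf-normalise j (inj₁ e) =
  σ , SameEdge-map (to σ) refl (cong leaf (transpose-here j 0F)) e
  where σ = permuteLeaves (transpose j 0F)
hubLeaf-normalise j (inj₂ e) =
  σ , SameEdge-map (to σ) refl (cong leaf (transpose-here j 0F)) e
  where σ = Iso-trans swapHubs (permuteLeaves (transpose j 0F))

star-edge : ∀ {m} (x y : Fin (1 + m)) → star-adj x y ≡ true → ∃[ j ] SameEdge x y centre (ray j)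
star-edge centre  (ray j) _ = j , inj₁ (refl , refl)
star-edge (ray j) centre  _ = j , inj₂ (refl , refl)

centreRay-normalise : ∀ {m} {x y : Fin (1 + suc m)} (j : Fin (suc m)) → SameEdge x y centre (ray j) →
                      Σ[ σ ∈ Iso (star (suc m)) (star (suc m)) ] SameEdge (to σ x) (to σ y) centre (ray 0F)
centreRay-normalise j e = σ , SameEdge-map (to σ) refl (cong ray (transpose-here j 0F)) e
  where σ = permuteRays (transpose j 0F)

-- The two chains

chain : Fin 2 → ℕ → Graph
chain 0F = fan
chain 1F = star

OnChain : Graph → Set
OnChain G = Σ[ i ∈ Fin 2 ] ∃[ k ] Iso G (chain i k)

contract-twoHub : ∀ {b} k → Contract1 (twoHub b k) H → OnChain H
contract-twoHub {b = b} k c with twoHub-edge b (u c) (v c) (edge c)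
... | inj₁ (refl , e) = 1F , k , Contract1-unique c (contract-hub₀-hub₁ k) e
contract-twoHub zero    c | inj₂ (() , _)
contract-twoHub (suc k) c | inj₂ (j , e) with σ , e′ ← hubLeaf-normalise j e =
  0F , k , Contract1-unique (Contract1-respˡ-Iso σ c) (contract-hub₀-leaf₀ k) e′

contract-star : ∀ m → Contract1 (star m) H → OnChain H
contract-star m c with star-edge (u c) (v c) (edge c)
contract-star zero    c | () , _
contract-star (suc m) c | j , e with σ , e′ ← centreRay-normalise j e =
  1F , m , Contract1-unique (Contract1-respˡ-Iso σ c) (contract-centre-ray₀ m) e′

contract-onChain : OnChain G → Contract1 G H → OnChain H
contract-onChain (0F , k , σ) c = contract-twoHub k (Contract1-respˡ-Iso σ c)
contract-onChain (1F , m , σ) c = contract-star m (Contract1-respˡ-Iso σ c)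

≤c-onChain : H ≤c G → OnChain G → OnChain H
≤c-onChain (done τ)   (i , k , σ) = i , k , Iso-trans (Iso-sym τ) σ
≤c-onChain (step c r) onChain     = ≤c-onChain r (contract-onChain onChain c)

Inc-onChain : ∀ {x} → Inc InA x → OnChain x
Inc-onChain (_ , _ , done τ , x≇y) = ⊥-elim (x≇y (Iso-sym τ))
Inc-onChain (_ , (p , _ , σ) , step c r , _) =
  ≤c-onChain r (contract-twoHub p (Contract1-respˡ-Iso (Iso-trans σ (K2-Iso-twoHub p)) c))

chain-contraction : ∀ i k → Contract1 (chain i (suc k)) (chain i k)
chain-contraction 0F = contract-hub₀-leaf₀
chain-contraction 1F = contract-centre-ray₀

chain-mono : ∀ i {k k′} → k ≤′ k′ → chain i k ≤c chain i k′
chain-mono i ≤′-refl      = done Iso-refl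
chain-mono i (≤′-step k≤) = step (chain-contraction i _) (chain-mono i k≤)

onChain-comparable : (a : OnChain G) (b : OnChain H) → proj₁ a ≡ proj₁ b → G ≤c H ⊎ H ≤c G
onChain-comparable (i , k , σ) (.i , k′ , τ) refl = Sum.map (compare σ τ) (compare τ σ) (≤-total k k′)
  where
  compare : ∀ {G H k k′} → Iso G (chain i k) → Iso H (chain i k′) → k ≤ k′ → G ≤c H
  compare σ τ k≤k′ = ≤c-respˡ-Iso σ (≤c-respʳ-Iso τ (chain-mono i (≤⇒≤′ k≤k′)))

corollary6 : WQO (Inc InA)
corollary6 = (λ f _ → <c-noInfiniteDescent f) , noAntichain
  where
  noAntichain : ∀ (f : ℕ → Graph) → (∀ i → Inc InA (f i)) →
                ¬ (∀ i j → i ≢ j → ¬ (f i ≤c f j) × ¬ (f j ≤c f i))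
  noAntichain f inc antichain =
    let i , j , i<j , same = pigeonhole (n<1+n 2) (proj₁ ∘ onChain ∘ toℕ)
        incomparable = antichain (toℕ i) (toℕ j) (<⇒≢ i<j)
    in [ proj₁ incomparable , proj₂ incomparable ]′ (onChain-comparable (onChain (toℕ i)) (onChain (toℕ j)) same)
    where
    onChain : ∀ i → OnChain (f i)
    onChain i = Inc-onChain (inc i)
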